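{- Let $k$ be a positive integer, $n=4k^2+l$ with $0<l<2k$, and let $\pi_n$ be the permutation of $[n]$ constructed in the context. If $X,Y\subseteq[n]$ are ample sets (with respect to $\pi_n$) and $(\pi_n)_X=(\pi_n)_Y$, then $X=Y$.
   Context: Patterns: for a sequence $t_1,\dots,t_m$ of distinct elements of a totally ordered set, its pattern is the unique permutation $\tau$ of $[m]$ with $t_i<t_j\iff\tau(i)<\tau(j)$; for a permutation $\sigma$ of $[n]$ and nonempty $X\subseteq[n]$, $\sigma_X$ is the pattern of the subsequence of $\sigma$ with indices in $X$. Permutation from a point set: given a finite set $S$ of $n$ lattice points $(c,r)$ (column $c$, row $r$), list the points in increasing order of $(c,r)$ lexicographically (by column, then by row) to get positions $1,\dots,n$, and assign values $1,\dots,n$ in increasing order of $(r,-c)$ lexicographically (by row, then larger column gets smaller value); the resulting permutation (the graph of the grid rotated slightly clockwise) is the permutation of $S$. Construction: let $a=\min(l,k)$, $b=l-a$ (so $0\le b<k$). Let $S$ consist of the main points $(c,r)$, $1\le c,r\le 2k$, together with the extra points $(2k+1,r)$ for $1\le r\le a$ (a partial column at the bottom right) and $(c,2k+1)$ for $2k-b+1\le c\le 2k$ (a partial row at the top right). Then $\pi_n$ is the permutation of $S$; its indices are identified with the points of $S$. (Restricted to the main points this gives the permutation $\pi_{4k^2}$ with $\pi_{4k^2}(2k(j-1)+i)=2ki-j+1$.) Ampleness: with $C_1=R_1=\{1,\dots,k\}$, $C_2=R_2=\{k+1,\dots,2k\}$, a set $X$ of indices is ample if its set $X'$ of main points satisfies: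 for every $a',b'\in\{1,2\}$, every row in $R_{b'}$ contains a point of $X'$ in some column of $C_{a'}$, and every column in $C_{a'}$ contains a point of $X'$ in some row of $R_{b'}$. -}

module Defs where

open import Data.Bool using (Bool; true; false; _∧_; _∨_; T)
open import Data.Nat using (ℕ; zero; suc; _+_; _*_; _∸_; _≤_; _<_; _<ᵇ_; _≤ᵇ_; _≡ᵇ_)
open import Data.Nat.Base using (_⊓_)
open import Data.Product using (_×_; _,_; proj₁; proj₂; ∃-syntax)
open import Data.List using (List; []; _∷_; map; concatMap; filter; length; lookup; allFin; upTo)
open import Data.Fin using (Fin; zero; suc)
open import Data.Fin.Subset using (Subset; _∈_)
open import Data.Fin.Subset.Properties using (_∈?_)
open import Relation.Binary.PropositionalEquality using (_≡_)

bfilter : {A : Set} → (A → Bool) → List A → List A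
bfilter p [] = []
bfilter p (x ∷ xs) with p x
... | true = x ∷ bfilter p xs
... | false = bfilter p xs

range : ℕ → List ℕ
range m = map suc (upTo m)

patternOf : List ℕ → List ℕ
patternOf ts = map (λ t → suc (length (bfilter (λ s → s <ᵇ t) ts))) ts

indicesIn : {n : ℕ} → Subset n → List (Fin n)
indicesIn {n} X = filter (λ i → i ∈? X) (allFin n)

-- σ_X for σ : Fin n → ℕ (a permutation of [n], values in 1..n)
restrictPat : {n : ℕ} → (Fin n → ℕ) → Subset n → List ℕ
restrictPat σ X = patternOf (map σ (indicesIn X))

Point : Set
Point = ℕ × ℕ

col : Point → ℕ
col = proj₁

row : Point → ℕ
row = proj₂

valBefore : Point → Point → Bool
valBefore (c' , r') (c , r) = (r' <ᵇ r) ∨ ((r' ≡ᵇ r) ∧ (c <ᵇ c'))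

-- permutation of a point set given as the list of its points sorted
-- lexicographically by (column, row); positions are Fin (length ps)
-- and value = 1 + number of points before it in the (r,-c) order.
permOf : (ps : List Point) → Fin (length ps) → ℕ
permOf ps i = suc (length (bfilter (λ q → valBefore q (lookup ps i)) ps))

aPar : ℕ → ℕ → ℕ
aPar k l = l ⊓ k

bPar : ℕ → ℕ → ℕ
bPar k l = l ∸ aPar k l

inRange : ℕ → ℕ → Bool
inRange x m = (1 ≤ᵇ x) ∧ (x ≤ᵇ m)

inS : ℕ → ℕ → Point → Bool
inS k l (c , r) =
  (inRange c (2 * k) ∧ inRange r (2 * k))
  ∨ ((c ≡ᵇ suc (2 * k)) ∧ inRange r (aPar k l))
  ∨ ((r ≡ᵇ suc (2 * k)) ∧ ((suc (2 * k ∸ bPar k l) ≤ᵇ c) ∧ (c ≤ᵇ 2 * k)))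

grid : ℕ → List Point
grid k = concatMap (λ c → map (λ r → (c , r)) (range (suc (2 * k)))) (range (suc (2 * k)))

Spts : ℕ → ℕ → List Point
Spts k l = bfilter (inS k l) (grid k)

-- n = |S| (= 4k² + l)
nOf : ℕ → ℕ → ℕ
nOf k l = length (Spts k l)

πn : (k l : ℕ) → Fin (nOf k l) → ℕ
πn k l = permOf (Spts k l)

pt : (k l : ℕ) → Fin (nOf k l) → Point
pt k l = lookup (Spts k l)

-- C_1 = R_1 = {1..k} (index zero), C_2 = R_2 = {k+1..2k} (index suc zero)
InBlock : ℕ → Fin 2 → ℕ → Set
InBlock k zero x = 1 ≤ x × x ≤ k
InBlock k (suc _) x = k < x × x ≤ 2 * k

Ample : (k l : ℕ) → Subset (nOf k l) → Set
Ample k l X = ∀ (a b : Fin 2) →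
  (∀ r → InBlock k b r →
     ∃[ i ] (i ∈ X × row (pt k l i) ≡ r × InBlock k a (col (pt k l i))))
  × (∀ c → InBlock k a c →
     ∃[ i ] (i ∈ X × col (pt k l i) ≡ c × InBlock k b (row (pt k l i))))

-- Pair the i-th smallest index of X with the i-th smallest index of Y (x ↦ y). Equal patterns
-- make ↦ preserve both the position order and the π-order. Within a column, position order and
-- π-order agree (both follow the row); within a row they are opposite. Hence the partners of an
-- inversion (x before x′ but π x′ < π x) cannot share a column, and the partners of a
-- non-inversion cannot share a row. Ampleness of X puts points of X in every row and column of
-- each quarter of the square, which supplies such comparison points next to every x; by
-- induction on d, col x ≥ d implies col y ≥ d, and row x ≥ d implies row y ≥ d. Exchanging X
-- and Y gives the reverse inequalities, so matched indices carry the same point and X = Y.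
module Submission where

open import Data.Bool using (Bool; true; false; T)
open import Data.Bool.Properties using (T-∧; T-∨)
open import Data.Empty using (⊥-elim)
open import Data.Fin using (Fin) renaming (_<_ to _<ꟳ_)
import Data.Fin.Properties as Fin
open import Data.Fin.Subset using (Subset; _⊆_) renaming (_∈_ to _∈ₛ_)
open import Data.Fin.Subset.Properties using (_∈?_; ⊆-antisym)
open import Data.List using (List; []; _∷_; map; length; lookup; filter; zip; allFin; concatMap)
open import Data.List.Membership.Propositional using (_∈_)
open import Data.List.Membership.Propositional.Properties
  using (∈-filter⁻; ∈-filter⁺; ∈-lookup; ∈-map⁺; ∈-allFin)
open import Data.List.Relation.Binary.Pointwise as Pointwise using (Pointwise; []; _∷_)
open import Data.List.Relation.Unary.All as All using (All; []; _∷_)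
import Data.List.Relation.Unary.All.Properties as All
open import Data.List.Relation.Unary.AllPairs as AllPairs using (AllPairs; []; _∷_)
import Data.List.Relation.Unary.AllPairs.Properties as AllPairs
open import Data.List.Relation.Unary.Any using (here; there)
open import Data.Nat
  using (ℕ; zero; suc; pred; _+_; _*_; _∸_; _⊓_; _≤_; _<_; _>_; _≤?_; _<ᵇ_; z≤n; s≤s)
open import Data.Nat.Properties
  using ( ≤-refl; ≤-reflexive; ≤-trans; ≤-antisym; <⇒≤; ≤-<-trans; <-≤-trans; <-trans
        ; <-irrefl; <-asym; ≰⇒>; ≮⇒≥; <⇒≱; m≤n⇒m<n∨m≡n; m≤n⇒m≤1+n; suc-injective; pred-mono-≤
        ; m≤m+n; +-monoʳ-≤; ⊓-glb; m⊓n≤n; +-distribʳ-⊓; m≤n+o⇒m∸n≤o; m+n≤o⇒m≤o∸n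
        ; <ᵇ⇒<; <⇒<ᵇ; ≡ᵇ⇒≡; ≡⇒≡ᵇ; ≤ᵇ⇒≤ )
open import Data.Product using (_×_; _,_; proj₁; proj₂; ∃-syntax; swap)
open import Data.Product.Relation.Binary.Lex.Strict
  using (×-Lex; ×-irreflexive; ×-asymmetric; ×-transitive)
open import Data.Sum as Sum using (_⊎_; inj₁; inj₂)
open import Function using (_⇔_; mk⇔; Equivalence; id; flip; _∘_)
open import Relation.Binary using (Asymmetric; tri<; tri≈; tri>)
open import Relation.Binary.PropositionalEquality
  using (_≡_; refl; sym; cong; cong₂; subst; subst₂; resp₂; isEquivalence)
open import Relation.Nullary using (¬_; yes; no)
open import Relation.Nullary.Decidable using (T?)

open import Defs

module _ {A : Set} (p : A → Bool) where

  bfilter≡filter : ∀ xs → bfilter p xs ≡ filter (λ x → T? (p x)) xs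
  bfilter≡filter [] = refl
  bfilter≡filter (x ∷ xs) with p x
  ... | true = cong (x ∷_) (bfilter≡filter xs)
  ... | false = bfilter≡filter xs

  ∈-bfilter⁻ : ∀ {x xs} → x ∈ bfilter p xs → x ∈ xs × T (p x)
  ∈-bfilter⁻ {xs = xs} x∈ =
    ∈-filter⁻ (λ x → T? (p x)) (subst (_ ∈_) (bfilter≡filter xs) x∈)

  bfilter⁺ : ∀ {R : A → A → Set} {xs} → AllPairs R xs → AllPairs R (bfilter p xs)
  bfilter⁺ {xs = xs} sorted =
    subst (AllPairs _) (sym (bfilter≡filter xs)) (AllPairs.filter⁺ (λ x → T? (p x)) sorted)

module _ {A : Set} {p q : A → Bool} (p⇒q : ∀ x → T (p x) → T (q x)) where

  length-bfilter-mono : ∀ xs → length (bfilter p xs) ≤ length (bfilter q xs)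
  length-bfilter-mono [] = z≤n
  length-bfilter-mono (x ∷ xs) with p x in px | q x in qx
  ... | true  | true  = s≤s (length-bfilter-mono xs)
  ... | true  | false = ⊥-elim (subst T qx (p⇒q x (subst T (sym px) _)))
  ... | false | true  = m≤n⇒m≤1+n (length-bfilter-mono xs)
  ... | false | false = length-bfilter-mono xs

  length-bfilter-< : ∀ {x xs} → x ∈ xs → T (q x) → ¬ T (p x) →
                     length (bfilter p xs) < length (bfilter q xs)
  length-bfilter-< {x} {_ ∷ xs} (here refl) qx ¬px with p x | q x
  ... | true  | _     = ⊥-elim (¬px _)
  ... | false | true  = s≤s (length-bfilter-mono xs)
  ... | false | false = ⊥-elim qx
  length-bfilter-< {xs = y ∷ _} (there x∈) qx ¬px with p y in py | q y in qy
  ... | true  | true  = s≤s (length-bfilter-< x∈ qx ¬px)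
  ... | true  | false = ⊥-elim (subst T qy (p⇒q y (subst T (sym py) _)))
  ... | false | true  = m≤n⇒m≤1+n (length-bfilter-< x∈ qx ¬px)
  ... | false | false = length-bfilter-< x∈ qx ¬px

module _ {A : Set} {R : A → A → Set} where

  AllPairs-lookup : ∀ {xs} → AllPairs R xs → ∀ {i j} → i <ꟳ j → R (lookup xs i) (lookup xs j)
  AllPairs-lookup {_ ∷ _} (x<xs ∷ _) {Fin.zero} {Fin.suc j} _ = All.lookup x<xs (∈-lookup j)
  AllPairs-lookup {_ ∷ _} (_ ∷ sorted) {Fin.suc _} {Fin.suc _} (s≤s i<j) =
    AllPairs-lookup sorted i<j

  module _ (irrefl : ∀ {x} → ¬ R x x) {xs : List A} (sorted : AllPairs R xs) where

    lookup-injective : ∀ {i j} → lookup xs i ≡ lookup xs j → i ≡ j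
    lookup-injective {i} {j} eq with Fin.<-cmp i j
    ... | tri< i<j _ _ = ⊥-elim (irrefl (subst (R _) (sym eq) (AllPairs-lookup sorted i<j)))
    ... | tri≈ _ i≡j _ = i≡j
    ... | tri> _ _ j<i = ⊥-elim (irrefl (subst (R _) eq (AllPairs-lookup sorted j<i)))

    lookup-<-reflects : Asymmetric R → ∀ {i j} → R (lookup xs i) (lookup xs j) → i <ꟳ j
    lookup-<-reflects asym {i} {j} r with Fin.<-cmp i j
    ... | tri< i<j _ _ = i<j
    ... | tri≈ _ refl _ = ⊥-elim (irrefl r)
    ... | tri> _ _ j<i = ⊥-elim (asym r (AllPairs-lookup sorted j<i))

  AllPairs-∈-related : ∀ {xs x y} → AllPairs R xs → x ∈ xs → y ∈ xs → x ≡ y ⊎ R x y ⊎ R y x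
  AllPairs-∈-related (_ ∷ _) (here refl) (here refl) = inj₁ refl
  AllPairs-∈-related (x<xs ∷ _) (here refl) (there y∈) = inj₂ (inj₁ (All.lookup x<xs y∈))
  AllPairs-∈-related (y<xs ∷ _) (there x∈) (here refl) = inj₂ (inj₂ (All.lookup y<xs x∈))
  AllPairs-∈-related (_ ∷ sorted) (there x∈) (there y∈) = AllPairs-∈-related sorted x∈ y∈

module _ {A B : Set} where

  ∈-zip⁻ : ∀ {xs : List A} {ys : List B} {x y} → (x , y) ∈ zip xs ys → x ∈ xs × y ∈ ys
  ∈-zip⁻ {_ ∷ _} {_ ∷ _} (here refl) = here refl , here refl
  ∈-zip⁻ {_ ∷ _} {_ ∷ _} (there xy∈) = let x∈ , y∈ = ∈-zip⁻ xy∈ in there x∈ , there y∈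

  ∈-zip-swap : ∀ {xs : List A} {ys : List B} {x y} → (x , y) ∈ zip xs ys → (y , x) ∈ zip ys xs
  ∈-zip-swap {_ ∷ _} {_ ∷ _} (here refl) = here refl
  ∈-zip-swap {_ ∷ _} {_ ∷ _} (there xy∈) = there (∈-zip-swap xy∈)

  ∈-zip-partner : ∀ {xs : List A} {ys : List B} {x} → length xs ≡ length ys → x ∈ xs →
                  ∃[ y ] (x , y) ∈ zip xs ys
  ∈-zip-partner {_ ∷ _} {y ∷ _} _ (here refl) = y , here refl
  ∈-zip-partner {_ ∷ _} {_ ∷ _} |xs|≡|ys| (there x∈) =
    let y , xy∈ = ∈-zip-partner (suc-injective |xs|≡|ys|) x∈ in y , there xy∈

  module _ {P : A → B → Set} where

    All-zip : ∀ {R : A → Set} {S : B → Set} {Q : A × B → Set} →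
              (∀ {x y} → P x y → R x → S y → Q (x , y)) →
              ∀ {xs ys} → Pointwise P xs ys → All R xs → All S ys → All Q (zip xs ys)
    All-zip f [] [] [] = []
    All-zip f (pxy ∷ ps) (rx ∷ rs) (sy ∷ ss) = f pxy rx sy ∷ All-zip f ps rs ss

    AllPairs-zip : ∀ {R : A → A → Set} {S : B → B → Set} {Q : A × B → A × B → Set} →
                   (∀ {x y x′ y′} → P x y → P x′ y′ → R x x′ → S y y′ → Q (x , y) (x′ , y′)) →
                   ∀ {xs ys} → Pointwise P xs ys → AllPairs R xs → AllPairs S ys →
                   AllPairs Q (zip xs ys)
    AllPairs-zip f [] [] [] = []
    AllPairs-zip f (pxy ∷ ps) (x<xs ∷ rs) (y<ys ∷ ss) =
      All-zip (f pxy) ps x<xs y<ys ∷ AllPairs-zip f ps rs ss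

    Pointwise-∈ : ∀ {xs ys} → Pointwise P xs ys →
                  Pointwise (λ x y → x ∈ xs × y ∈ ys × P x y) xs ys
    Pointwise-∈ [] = []
    Pointwise-∈ (pxy ∷ ps) = (here refl , here refl , pxy)
      ∷ Pointwise.map (λ (x∈ , y∈ , p) → there x∈ , there y∈ , p) (Pointwise-∈ ps)

pred-between : ∀ {d n} → suc d < n → d < pred n × pred n < n
pred-between {n = suc _} (s≤s d<n) = d<n , ≤-refl

rank : ℕ → List ℕ → ℕ
rank t ts = length (bfilter (_<ᵇ t) ts)

rank-mono : ∀ ts {t t′} → t ≤ t′ → rank t ts ≤ rank t′ ts
rank-mono ts {t} t≤t′ =
  length-bfilter-mono (λ s s<t → <⇒<ᵇ (<-≤-trans (<ᵇ⇒< s t s<t) t≤t′)) ts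

rank-< : ∀ {ts t t′} → t ∈ ts → t < t′ → rank t ts < rank t′ ts
rank-< {t = t} t∈ t<t′ =
  length-bfilter-< (λ s s<t → <⇒<ᵇ (<-trans (<ᵇ⇒< s t s<t) t<t′)) t∈ (<⇒<ᵇ t<t′)
                   (λ t<t → <-irrefl refl (<ᵇ⇒< t t t<t))

rank-<-reflects : ∀ ts {t t′} → rank t ts < rank t′ ts → t < t′
rank-<-reflects ts r<r′ = ≰⇒> (λ t′≤t → <⇒≱ r<r′ (rank-mono ts t′≤t))

rank≡⇒<-transfer : ∀ {ts us t t′ u u′} → t ∈ ts →
                   rank t ts ≡ rank u us → rank t′ ts ≡ rank u′ us → t < t′ → u < u′
rank≡⇒<-transfer {us = us} t∈ r≡ r′≡ t<t′ =
  rank-<-reflects us (subst₂ _<_ r≡ r′≡ (rank-< t∈ t<t′))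

patternOf-≡⇒rank≡ : ∀ {A : Set} (σ : A → ℕ) {xs ys} →
                    patternOf (map σ xs) ≡ patternOf (map σ ys) →
                    Pointwise (λ x y → rank (σ x) (map σ xs) ≡ rank (σ y) (map σ ys)) xs ys
patternOf-≡⇒rank≡ σ {xs} {ys} eq =
  Pointwise.map⁻ σ σ (Pointwise.map suc-injective
    (Pointwise.map⁻ (λ t → suc (rank t (map σ xs))) (λ u → suc (rank u (map σ ys)))
      (Pointwise.≡⇒Pointwise-≡ eq)))

module _ {n : ℕ} where

  indicesIn-sorted : (X : Subset n) → AllPairs _<ꟳ_ (indicesIn X)
  indicesIn-sorted X = AllPairs.filter⁺ (_∈? X) (AllPairs.tabulate⁺-< id)

  ∈-indicesIn⁺ : ∀ {X : Subset n} {i} → i ∈ₛ X → i ∈ indicesIn X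
  ∈-indicesIn⁺ {X} {i} i∈X = ∈-filter⁺ (_∈? X) (∈-allFin i) i∈X

  ∈-indicesIn⁻ : ∀ {X : Subset n} {i} → i ∈ indicesIn X → i ∈ₛ X
  ∈-indicesIn⁻ {X} i∈ = proj₂ (∈-filter⁻ (_∈? X) {xs = allFin n} i∈)

  OrderMatched : (σ : Fin n → ℕ) → Fin n × Fin n → Fin n × Fin n → Set
  OrderMatched σ (x , y) (x′ , y′) = x <ꟳ x′ × y <ꟳ y′ × (σ x < σ x′ ⇔ σ y < σ y′)

  module _ (σ : Fin n → ℕ) {X Y : Subset n} (same : restrictPat σ X ≡ restrictPat σ Y) where

    restrictPat-≡⇒length≡ : length (indicesIn X) ≡ length (indicesIn Y)
    restrictPat-≡⇒length≡ = Pointwise.Pointwise-length (patternOf-≡⇒rank≡ σ same)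

    restrictPat-≡⇒orderMatched : AllPairs (OrderMatched σ) (zip (indicesIn X) (indicesIn Y))
    restrictPat-≡⇒orderMatched =
      AllPairs-zip matched (Pointwise-∈ (patternOf-≡⇒rank≡ σ same))
                   (indicesIn-sorted X) (indicesIn-sorted Y)
      where
      xs = indicesIn X
      ys = indicesIn Y
      SameRank : Fin n → Fin n → Set
      SameRank x y = x ∈ xs × y ∈ ys × rank (σ x) (map σ xs) ≡ rank (σ y) (map σ ys)
      matched : ∀ {x y x′ y′} → SameRank x y → SameRank x′ y′ → x <ꟳ x′ → y <ꟳ y′ →
                OrderMatched σ (x , y) (x′ , y′)
      matched (x∈ , y∈ , r≡) (_ , _ , r′≡) x<x′ y<y′ =
        x<x′ , y<y′ , mk⇔ (rank≡⇒<-transfer {us = map σ ys} (∈-map⁺ σ x∈) r≡ r′≡)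
                          (rank≡⇒<-transfer {us = map σ xs} (∈-map⁺ σ y∈) (sym r≡) (sym r′≡))

PosOrder : Point → Point → Set
PosOrder = ×-Lex _≡_ _<_ _<_

PosOrder-irrefl : ∀ {p} → ¬ PosOrder p p
PosOrder-irrefl = ×-irreflexive {_≈₁_ = _≡_} {_<₁_ = _<_} {_≈₂_ = _≡_} {_<₂_ = _<_}
                    <-irrefl <-irrefl (refl , refl)

PosOrder-asym : Asymmetric PosOrder
PosOrder-asym = ×-asymmetric {_≈₁_ = _≡_} {_<₁_ = _<_} {_<₂_ = _<_} sym (resp₂ _<_) <-asym <-asym

ValueOrder : Point → Point → Set
ValueOrder q p = ×-Lex _≡_ _<_ _>_ (swap q) (swap p)

ValueOrder-irrefl : ∀ {p} → ¬ ValueOrder p p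
ValueOrder-irrefl = ×-irreflexive {_≈₁_ = _≡_} {_<₁_ = _<_} {_≈₂_ = _≡_} {_<₂_ = _>_}
                      <-irrefl (λ eq → <-irrefl (sym eq)) (refl , refl)

ValueOrder-trans : ∀ {p q r} → ValueOrder p q → ValueOrder q r → ValueOrder p r
ValueOrder-trans = ×-transitive {_≈₁_ = _≡_} {_<₁_ = _<_} {_<₂_ = _>_}
                     isEquivalence (resp₂ _<_) <-trans (flip <-trans)

valBefore⇒ValueOrder : ∀ q p → T (valBefore q p) → ValueOrder q p
valBefore⇒ValueOrder (c′ , r′) (c , r) =
  Sum.map (<ᵇ⇒< r′ r) (λ h → let eq , lt = Equivalence.to T-∧ h in ≡ᵇ⇒≡ r′ r eq , <ᵇ⇒< c c′ lt)
    ∘ Equivalence.to T-∨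

ValueOrder⇒valBefore : ∀ q p → ValueOrder q p → T (valBefore q p)
ValueOrder⇒valBefore (c′ , r′) (c , r) =
  Equivalence.from T-∨
    ∘ Sum.map <⇒<ᵇ (λ (eq , lt) → Equivalence.from T-∧ (≡⇒≡ᵇ r′ r eq , <⇒<ᵇ lt))

permOf-mono : ∀ ps {i j} → ValueOrder (lookup ps i) (lookup ps j) → permOf ps i < permOf ps j
permOf-mono ps {i} {j} pᵢ<pⱼ =
  s≤s (length-bfilter-< below {xs = ps} (∈-lookup i) (ValueOrder⇒valBefore pᵢ pⱼ pᵢ<pⱼ)
                        (ValueOrder-irrefl ∘ valBefore⇒ValueOrder pᵢ pᵢ))
  where
  pᵢ = lookup ps i
  pⱼ = lookup ps j
  below : ∀ s → T (valBefore s pᵢ) → T (valBefore s pⱼ)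
  below s s<pᵢ =
    ValueOrder⇒valBefore s pⱼ (ValueOrder-trans (valBefore⇒ValueOrder s pᵢ s<pᵢ) pᵢ<pⱼ)

range-sorted : ∀ m → AllPairs _<_ (range m)
range-sorted m = AllPairs.map⁺ (AllPairs.applyUpTo⁺₁ id m (λ i<j _ → s≤s i<j))

columnwise-sorted : ∀ {cs rs} → AllPairs _<_ cs → AllPairs _<_ rs →
                    AllPairs PosOrder (concatMap (λ c → map (λ r → (c , r)) rs) cs)
columnwise-sorted {cs} {rs} cs-sorted rs-sorted =
  AllPairs.concat⁺ (All.map⁺ (All.universal column-sorted cs))
                   (AllPairs.map⁺ (AllPairs.map columns-ordered cs-sorted))
  where
  column : ℕ → List Point
  column c = map (λ r → (c , r)) rs
  column-sorted : ∀ c → AllPairs PosOrder (column c)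
  column-sorted _ = AllPairs.map⁺ (AllPairs.map (λ r<r′ → inj₂ (refl , r<r′)) rs-sorted)
  columns-ordered : ∀ {c c′} → c < c′ → All (λ p → All (PosOrder p) (column c′)) (column c)
  columns-ordered c<c′ =
    All.map⁺ (All.universal (λ _ → All.map⁺ (All.universal (λ _ → inj₁ c<c′) rs)) rs)

Spts-sorted : ∀ k l → AllPairs PosOrder (Spts k l)
Spts-sorted k l =
  bfilter⁺ (inS k l) (columnwise-sorted (range-sorted (suc (2 * k))) (range-sorted (suc (2 * k))))

data Shape (k : ℕ) : Point → Set where
  main       : ∀ {c r} → 1 ≤ c → c ≤ 2 * k → 1 ≤ r → r ≤ 2 * k → Shape k (c , r)
  lastColumn : ∀ {r} → 1 ≤ r → r ≤ k → Shape k (suc (2 * k) , r)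
  lastRow    : ∀ {c} → k < c → c ≤ 2 * k → Shape k (c , suc (2 * k))

k≤2k∸bPar : ∀ {k l} → l < 2 * k → k ≤ 2 * k ∸ bPar k l
k≤2k∸bPar {k} {l} l<2k = m+n≤o⇒m≤o∸n k (+-monoʳ-≤ k (m≤n+o⇒m∸n≤o l (l ⊓ k) l≤l⊓k+k))
  where
  -- 2 * k unfolds to k + (k + 0)
  l≤l⊓k+k : l ≤ l ⊓ k + (k + 0)
  l≤l⊓k+k = ≤-trans (⊓-glb (m≤m+n l (k + 0)) (<⇒≤ l<2k))
                    (≤-reflexive (sym (+-distribʳ-⊓ (k + 0) l k)))

T-inRange : ∀ {x m} → T (inRange x m) → 1 ≤ x × x ≤ m
T-inRange {x} {m} h = let lo , hi = Equivalence.to T-∧ h in ≤ᵇ⇒≤ 1 x lo , ≤ᵇ⇒≤ x m hi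

inS⇒Shape : ∀ {k l} → l < 2 * k → ∀ p → T (inS k l p) → Shape k p
inS⇒Shape {k} {l} l<2k (c , r) p∈S with Equivalence.to T-∨ p∈S
... | inj₁ square =
  let c∈ , r∈ = Equivalence.to (T-∧ {inRange c (2 * k)}) square
      1≤c , c≤2k = T-inRange c∈
      1≤r , r≤2k = T-inRange r∈
  in main 1≤c c≤2k 1≤r r≤2k
... | inj₂ extra with Equivalence.to T-∨ extra
...   | inj₁ column =
  let c≡ , r∈ = Equivalence.to T-∧ column
      1≤r , r≤a = T-inRange r∈
  in subst (λ c → Shape k (c , r)) (sym (≡ᵇ⇒≡ c _ c≡))
       (lastColumn 1≤r (≤-trans r≤a (m⊓n≤n l k)))
...   | inj₂ row =
  let r≡ , c∈ = Equivalence.to T-∧ row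
      lo , hi = Equivalence.to T-∧ c∈
  in subst (λ r → Shape k (c , r)) (sym (≡ᵇ⇒≡ r _ r≡))
       (lastRow (<-≤-trans (s≤s (k≤2k∸bPar l<2k)) (≤ᵇ⇒≤ _ c lo)) (≤ᵇ⇒≤ c _ hi))

module _ {k : ℕ} where

  1≤col : ∀ {p} → Shape k p → 1 ≤ col p
  1≤col (main 1≤c _ _ _) = 1≤c
  1≤col (lastColumn _ _) = s≤s z≤n
  1≤col (lastRow k<c _)  = <-≤-trans (s≤s z≤n) k<c

  1≤row : ∀ {p} → Shape k p → 1 ≤ row p
  1≤row (main _ _ 1≤r _)   = 1≤r
  1≤row (lastColumn 1≤r _) = 1≤r
  1≤row (lastRow _ _)      = s≤s z≤n

  col≤1+2k : ∀ {p} → Shape k p → col p ≤ suc (2 * k)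
  col≤1+2k (main _ c≤2k _ _) = m≤n⇒m≤1+n c≤2k
  col≤1+2k (lastColumn _ _)  = ≤-refl
  col≤1+2k (lastRow _ c≤2k)  = m≤n⇒m≤1+n c≤2k

  row≤1+2k : ∀ {p} → Shape k p → row p ≤ suc (2 * k)
  row≤1+2k (main _ _ _ r≤2k)  = m≤n⇒m≤1+n r≤2k
  row≤1+2k (lastColumn _ r≤k) = m≤n⇒m≤1+n (≤-trans r≤k (m≤m+n k (k + 0)))
  row≤1+2k (lastRow _ _)      = ≤-refl

  k<row⇒col≤2k : ∀ {p} → Shape k p → k < row p → col p ≤ 2 * k
  k<row⇒col≤2k (main _ c≤2k _ _)  _   = c≤2k
  k<row⇒col≤2k (lastColumn _ r≤k) k<r = ⊥-elim (<⇒≱ k<r r≤k)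
  k<row⇒col≤2k (lastRow _ c≤2k)   _   = c≤2k

  col≤k⇒row≤2k : ∀ {p} → Shape k p → col p ≤ k → row p ≤ 2 * k
  col≤k⇒row≤2k (main _ _ _ r≤2k) _   = r≤2k
  col≤k⇒row≤2k (lastColumn _ _)  c≤k = ⊥-elim (<⇒≱ (s≤s (m≤m+n k (k + 0))) c≤k)
  col≤k⇒row≤2k (lastRow k<c _)   c≤k = ⊥-elim (<⇒≱ k<c c≤k)

module Construction (k l : ℕ) (l<2k : l < 2 * k) where

  P : Fin (nOf k l) → Point
  P = pt k l

  C R : Fin (nOf k l) → ℕ
  C = col ∘ P
  R = row ∘ P

  π : Fin (nOf k l) → ℕ
  π = πn k l

  shape : ∀ i → Shape k (P i)
  shape i = inS⇒Shape l<2k (P i) (proj₂ (∈-bfilter⁻ (inS k l) {xs = grid k} (∈-lookup i)))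

  P-injective : ∀ {i j} → P i ≡ P j → i ≡ j
  P-injective = lookup-injective PosOrder-irrefl (Spts-sorted k l)

  pos<⇒PosOrder : ∀ {i j} → i <ꟳ j → PosOrder (P i) (P j)
  pos<⇒PosOrder = AllPairs-lookup (Spts-sorted k l)

  PosOrder⇒pos< : ∀ {i j} → PosOrder (P i) (P j) → i <ꟳ j
  PosOrder⇒pos< = lookup-<-reflects PosOrder-irrefl (Spts-sorted k l) PosOrder-asym

  col<⇒pos< : ∀ {i j} → C i < C j → i <ꟳ j
  col<⇒pos< = PosOrder⇒pos< ∘ inj₁

  sameCol⇒pos< : ∀ {i j} → C i ≡ C j → R i < R j → i <ꟳ j
  sameCol⇒pos< Ci≡Cj Ri<Rj = PosOrder⇒pos< (inj₂ (Ci≡Cj , Ri<Rj))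

  pos<⇒col≤ : ∀ {i j} → i <ꟳ j → C i ≤ C j
  pos<⇒col≤ i<j with pos<⇒PosOrder i<j
  ... | inj₁ Ci<Cj = <⇒≤ Ci<Cj
  ... | inj₂ (Ci≡Cj , _) = ≤-reflexive Ci≡Cj

  row<⇒π< : ∀ {i j} → R i < R j → π i < π j
  row<⇒π< Ri<Rj = permOf-mono (Spts k l) (inj₁ Ri<Rj)

  π<⇒row< : ∀ {i j} → i <ꟳ j → π i < π j → R i < R j
  π<⇒row< {i} {j} i<j πi<πj = ≰⇒> Rj≮Ri
    where
    Rj≮Ri : ¬ R j ≤ R i
    Rj≮Ri Rj≤Ri with m≤n⇒m<n∨m≡n Rj≤Ri | pos<⇒PosOrder i<j
    ... | inj₁ Rj<Ri | _                = <-asym πi<πj (row<⇒π< Rj<Ri)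
    ... | inj₂ Rj≡Ri | inj₁ Ci<Cj       = <-asym πi<πj (permOf-mono (Spts k l) (inj₂ (Rj≡Ri , Ci<Cj)))
    ... | inj₂ Rj≡Ri | inj₂ (_ , Ri<Rj) = <-irrefl (sym Rj≡Ri) Ri<Rj

  firstHalf secondHalf : Fin 2
  firstHalf = Fin.zero
  secondHalf = Fin.suc Fin.zero

  blockOf : ∀ {x} → 1 ≤ x → x ≤ 2 * k → ∃[ a ] InBlock k a x
  blockOf {x} 1≤x x≤2k with x ≤? k
  ... | yes x≤k = firstHalf , 1≤x , x≤k
  ... | no x≰k = secondHalf , ≰⇒> x≰k , x≤2k

  module Domination (X : Subset (nOf k l)) (ample : Ample k l X)
                    (Z : List (Fin (nOf k l) × Fin (nOf k l))) (Z-matched : AllPairs (OrderMatched π) Z)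
                    (partner : ∀ {i} → i ∈ₛ X → ∃[ y ] (i , y) ∈ Z) where

    _↦_ : Fin (nOf k l) → Fin (nOf k l) → Set
    x ↦ y = (x , y) ∈ Z

    matched : ∀ {x y x′ y′} → x ↦ y → x′ ↦ y′ → x <ꟳ x′ → OrderMatched π (x , y) (x′ , y′)
    matched xy x′y′ x<x′ with AllPairs-∈-related Z-matched xy x′y′
    ... | inj₁ refl = ⊥-elim (Fin.<-irrefl refl x<x′)
    ... | inj₂ (inj₁ m) = m
    ... | inj₂ (inj₂ m) = ⊥-elim (Fin.<-asym x<x′ (proj₁ m))

    matched-< : ∀ {x y x′ y′} → x ↦ y → x′ ↦ y′ → x <ꟳ x′ → y <ꟳ y′
    matched-< xy x′y′ x<x′ = proj₁ (proj₂ (matched xy x′y′ x<x′))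

    matched-π⇒ : ∀ {x y x′ y′} → x ↦ y → x′ ↦ y′ → x <ꟳ x′ → π x < π x′ → π y < π y′
    matched-π⇒ xy x′y′ x<x′ = Equivalence.to (proj₂ (proj₂ (matched xy x′y′ x<x′)))

    matched-π⇐ : ∀ {x y x′ y′} → x ↦ y → x′ ↦ y′ → x <ꟳ x′ → π y < π y′ → π x < π x′
    matched-π⇐ xy x′y′ x<x′ = Equivalence.from (proj₂ (proj₂ (matched xy x′y′ x<x′)))

    pointInColumn : ∀ b {c} → 1 ≤ c → c ≤ 2 * k → ∃[ i ] (i ∈ₛ X × C i ≡ c × InBlock k b (R i))
    pointInColumn b {c} 1≤c c≤2k = let a , c∈a = blockOf 1≤c c≤2k in proj₂ (ample a b) c c∈a

    pointInRow : ∀ a {r} → 1 ≤ r → r ≤ 2 * k → ∃[ i ] (i ∈ₛ X × R i ≡ r × InBlock k a (C i))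
    pointInRow a {r} 1≤r r≤2k = let b , r∈b = blockOf 1≤r r≤2k in proj₁ (ample a b) r r∈b

    highPointInColumnBefore : ∀ {d} x → suc d < C x →
                              ∃[ i ] (i ∈ₛ X × d < C i × C i < C x × k < R i)
    highPointInColumnBefore {d} x sd<Cx =
      let d<c , c<Cx = pred-between sd<Cx
          i , i∈X , Ci≡c , k<Ri , _ =
            pointInColumn secondHalf (≤-<-trans z≤n d<c) (pred-mono-≤ (col≤1+2k (shape x)))
      in i , i∈X , subst (d <_) (sym Ci≡c) d<c , subst (_< C x) (sym Ci≡c) c<Cx , k<Ri

    leftPointInRowBefore : ∀ {d} x → suc d < R x →
                           ∃[ i ] (i ∈ₛ X × d < R i × R i < R x × C i ≤ k)
    leftPointInRowBefore {d} x sd<Rx =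
      let d<r , r<Rx = pred-between sd<Rx
          i , i∈X , Ri≡r , _ , Ci≤k =
            pointInRow firstHalf (≤-<-trans z≤n d<r) (pred-mono-≤ (row≤1+2k (shape x)))
      in i , i∈X , subst (d <_) (sym Ri≡r) d<r , subst (_< R x) (sym Ri≡r) r<Rx , Ci≤k

    lowPointInColumn : ∀ x → k < R x → ∃[ i ] (i ∈ₛ X × C i ≡ C x × R i ≤ k)
    lowPointInColumn x k<Rx =
      let i , i∈X , Ci≡Cx , _ , Ri≤k =
            pointInColumn firstHalf (1≤col (shape x)) (k<row⇒col≤2k (shape x) k<Rx)
      in i , i∈X , Ci≡Cx , Ri≤k

    rightPointInRow : ∀ x → C x ≤ k → ∃[ j ] (j ∈ₛ X × R j ≡ R x × k < C j)
    rightPointInRow x Cx≤k =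
      let j , j∈X , Rj≡Rx , k<Cj , _ =
            pointInRow secondHalf (1≤row (shape x)) (col≤k⇒row≤2k (shape x) Cx≤k)
      in j , j∈X , Rj≡Rx , k<Cj

    -- x precedes x′ but has the larger π-value; two points of one column have π-order equal to
    -- their position order, so the partners cannot share a column.
    col-gap : ∀ {x y x′ y′} → x ↦ y → x′ ↦ y′ → C x < C x′ → R x′ < R x → C y < C y′
    col-gap xy x′y′ Cx<Cx′ Rx′<Rx with pos<⇒PosOrder (matched-< xy x′y′ (col<⇒pos< Cx<Cx′))
    ... | inj₁ Cy<Cy′ = Cy<Cy′
    ... | inj₂ (_ , Ry<Ry′) =
      ⊥-elim (<-asym (row<⇒π< Rx′<Rx) (matched-π⇐ xy x′y′ (col<⇒pos< Cx<Cx′) (row<⇒π< Ry<Ry′)))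

    lowMatchInColumn : ∀ {x y} → x ↦ y →
                       ∃[ x′ ] ∃[ y′ ] (x′ ↦ y′ × C x′ ≡ C x × R x′ ≤ k × C y′ ≤ C y)
    lowMatchInColumn {x} {y} xy with R x ≤? k
    ... | yes Rx≤k = x , y , xy , refl , Rx≤k , ≤-refl
    ... | no Rx≰k =
      let i , i∈X , Ci≡Cx , Ri≤k = lowPointInColumn x (≰⇒> Rx≰k)
          yi , iyi = partner i∈X
          i<x = sameCol⇒pos< Ci≡Cx (≤-<-trans Ri≤k (≰⇒> Rx≰k))
      in i , yi , iyi , Ci≡Cx , Ri≤k , pos<⇒col≤ (matched-< iyi xy i<x)

    col-bound : ∀ d {x y} → x ↦ y → d ≤ C x → d ≤ C y
    col-bound zero _ _ = z≤n
    col-bound (suc zero) {y = y} _ _ = 1≤col (shape y)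
    col-bound (suc (suc d)) {x} xy sd<Cx =
      let i , i∈X , d<Ci , Ci<Cx , k<Ri = highPointInColumnBefore x sd<Cx
          yi , iyi = partner i∈X
          x′ , y′ , x′y′ , Cx′≡Cx , Rx′≤k , Cy′≤Cy = lowMatchInColumn xy
          Cyi<Cy′ = col-gap iyi x′y′ (subst (C i <_) (sym Cx′≡Cx) Ci<Cx) (≤-<-trans Rx′≤k k<Ri)
      in <-≤-trans (≤-<-trans (col-bound (suc d) iyi d<Ci) Cyi<Cy′) Cy′≤Cy

    row-gap-before : ∀ {i yi x y} → i ↦ yi → x ↦ y → C i < C x → R i < R x → R yi < R y
    row-gap-before iyi xy Ci<Cx Ri<Rx =
      π<⇒row< (matched-< iyi xy i<x) (matched-π⇒ iyi xy i<x (row<⇒π< Ri<Rx))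
      where i<x = col<⇒pos< Ci<Cx

    sameRow-bound : ∀ {x y j yj} → x ↦ y → j ↦ yj → C x < C j → R x ≡ R j → R yj ≤ R y
    sameRow-bound xy jyj Cx<Cj Rx≡Rj = ≮⇒≥ λ Ry<Ryj →
      <-irrefl Rx≡Rj (π<⇒row< x<j (matched-π⇐ xy jyj x<j (row<⇒π< Ry<Ryj)))
      where x<j = col<⇒pos< Cx<Cj

    -- If x lies in the left half, i need not precede x: compare i instead with a point j of the
    -- right half in the row of x.
    row-gap : ∀ {i yi x y} → i ↦ yi → x ↦ y → R i < R x → C i ≤ k → R yi < R y
    row-gap {i} {x = x} iyi xy Ri<Rx Ci≤k with C x ≤? k
    ... | no Cx≰k = row-gap-before iyi xy (≤-<-trans Ci≤k (≰⇒> Cx≰k)) Ri<Rx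
    ... | yes Cx≤k =
      let j , j∈X , Rj≡Rx , k<Cj = rightPointInRow x Cx≤k
          yj , jyj = partner j∈X
      in <-≤-trans (row-gap-before iyi jyj (≤-<-trans Ci≤k k<Cj) (subst (R i <_) (sym Rj≡Rx) Ri<Rx))
                   (sameRow-bound xy jyj (≤-<-trans Cx≤k k<Cj) (sym Rj≡Rx))

    row-bound : ∀ d {x y} → x ↦ y → d ≤ R x → d ≤ R y
    row-bound zero _ _ = z≤n
    row-bound (suc zero) {y = y} _ _ = 1≤row (shape y)
    row-bound (suc (suc d)) {x} xy sd<Rx =
      let i , i∈X , d<Ri , Ri<Rx , Ci≤k = leftPointInRowBefore x sd<Rx
          yi , iyi = partner i∈X
      in ≤-<-trans (row-bound (suc d) iyi d<Ri) (row-gap iyi xy Ri<Rx Ci≤k)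

    dominated : ∀ {x y} → x ↦ y → C x ≤ C y × R x ≤ R y
    dominated {x} xy = col-bound (C x) xy ≤-refl , row-bound (R x) xy ≤-refl

  matched-dominated : ∀ {X Y} → Ample k l X → restrictPat π X ≡ restrictPat π Y →
                      ∀ {x y} → (x , y) ∈ zip (indicesIn X) (indicesIn Y) → C x ≤ C y × R x ≤ R y
  matched-dominated {X} ample same = Domination.dominated X ample _ (restrictPat-≡⇒orderMatched π same)
    (∈-zip-partner (restrictPat-≡⇒length≡ π same) ∘ ∈-indicesIn⁺)

  matched⇒≡ : ∀ {X Y} → Ample k l X → Ample k l Y → restrictPat π X ≡ restrictPat π Y →
              ∀ {x y} → (x , y) ∈ zip (indicesIn X) (indicesIn Y) → x ≡ y
  matched⇒≡ ampleX ampleY same xy =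
    let Cx≤Cy , Rx≤Ry = matched-dominated ampleX same xy
        Cy≤Cx , Ry≤Rx = matched-dominated ampleY (sym same) (∈-zip-swap xy)
    in P-injective (cong₂ _,_ (≤-antisym Cx≤Cy Cy≤Cx) (≤-antisym Rx≤Ry Ry≤Rx))

  ample-samePattern⇒⊆ : ∀ {X Y} → Ample k l X → Ample k l Y →
                        restrictPat π X ≡ restrictPat π Y → X ⊆ Y
  ample-samePattern⇒⊆ {Y = Y} ampleX ampleY same i∈X =
    let y , iy = ∈-zip-partner (restrictPat-≡⇒length≡ π same) (∈-indicesIn⁺ i∈X)
    in subst (_∈ₛ Y) (sym (matched⇒≡ ampleX ampleY same iy)) (∈-indicesIn⁻ (proj₂ (∈-zip⁻ iy)))

mainTheorem5 : (k l : ℕ) → 0 < k → 0 < l → l < 2 * k →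
    (X Y : Subset (nOf k l)) → Ample k l X → Ample k l Y →
    restrictPat (πn k l) X ≡ restrictPat (πn k l) Y → X ≡ Y
mainTheorem5 k l _ _ l<2k X Y ampleX ampleY same =
  ⊆-antisym (ample-samePattern⇒⊆ ampleX ampleY same) (ample-samePattern⇒⊆ ampleY ampleX (sym same))
  where open Construction k l l<2k
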